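{- Every cartesian monoidal category $(\mathcal{C},\times,1)$ is productive.
   Context: Composition in diagrammatic order $;$, coherence isomorphisms suppressed. For objects $P,Q$ write $\langle h\rangle$ for the class of $h\colon P\to W\otimes Q$ in $\int^W\mathcal{C}(P,W\otimes Q)$: the set of morphisms $P\to W\otimes Q$ with $W$ varying, modulo the equivalence relation generated by $h;(r\otimes1_Q)\sim h$ for $h\colon P\to N\otimes Q$, $r\colon N\to W$. A symmetric monoidal category $\mathcal{C}$ is productive if for all objects $X_0,Y_0$ every class $\alpha\in\int^M\mathcal{C}(X_0,M\otimes Y_0)$ is terminating: there exist an object $M_0$, a morphism $\alpha_0\colon X_0\to M_0\otimes Y_0$, and for each representative $\alpha_i\colon X_0\to M_i\otimes Y_0$ of $\alpha$ a morphism $s_i\colon M_0\to M_i$ with $\alpha_i=\alpha_0;(s_i\otimes1_{Y_0})$, such that for all objects $A,B,U,V$ and morphisms $u\colon M_i\otimes A\to U\otimes B$, $v\colon M_j\otimes A\to V\otimes B$, the equality $\langle(\alpha_i\otimes1_A);(u\otimes1_{Y_0})\rangle=\langle(\alpha_j\otimes1_A);(v\otimes1_{Y_0})\rangle$ in $\int^W\mathcal{C}(X_0\otimes A,W\otimes B\otimes Y_0)$ (symmetries inserted) implies $\langle(s_i\otimes1_A);u\rangle=\langle(s_j\otimes1_A);v\rangle$ in $\int^W\mathcal{C}(M_0\otimes A,W\otimes B)$. -}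

module Defs where

open import Level using (Level; _⊔_) renaming (suc to lsuc)
open import Relation.Binary using (Rel; IsEquivalence)

-- A (locally small) category with setoid-valued hom-sets.
-- Composition is written in diagrammatic order:  f ⨾ g  means "first f, then g".
record Category (o ℓ e : Level) : Set (lsuc (o ⊔ ℓ ⊔ e)) where
  infix  4 _≈_
  infixr 9 _⨾_
  field
    Obj   : Set o
    _⇒_   : Obj → Obj → Set ℓ
    _≈_   : ∀ {A B} → Rel (A ⇒ B) e
    id    : ∀ {A} → A ⇒ A
    _⨾_   : ∀ {A B C} → A ⇒ B → B ⇒ C → A ⇒ C
    ≈-equiv   : ∀ {A B} → IsEquivalence (_≈_ {A} {B})
    ⨾-resp-≈  : ∀ {A B C} {f f' : A ⇒ B} {g g' : B ⇒ C} →
                f ≈ f' → g ≈ g' → f ⨾ g ≈ f' ⨾ g'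
    identityˡ : ∀ {A B} {f : A ⇒ B} → id ⨾ f ≈ f
    identityʳ : ∀ {A B} {f : A ⇒ B} → f ⨾ id ≈ f
    assoc     : ∀ {A B C D} {f : A ⇒ B} {g : B ⇒ C} {h : C ⇒ D} →
                (f ⨾ g) ⨾ h ≈ f ⨾ (g ⨾ h)

-- Cartesian structure: a chosen terminal object and chosen binary products.
-- The cartesian monoidal category (C, ×, 1) is the monoidal structure induced by it.
record Cartesian {o ℓ e : Level} (C : Category o ℓ e) : Set (o ⊔ ℓ ⊔ e) where
  open Category C
  infixr 7 _×_
  field
    𝟙        : Obj
    !        : ∀ {A} → A ⇒ 𝟙
    !-unique : ∀ {A} (f : A ⇒ 𝟙) → f ≈ !
    _×_      : Obj → Obj → Obj
    π₁       : ∀ {A B} → (A × B) ⇒ A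
    π₂       : ∀ {A B} → (A × B) ⇒ B
    ⟨_,_⟩    : ∀ {X A B} → X ⇒ A → X ⇒ B → X ⇒ (A × B)
    project₁ : ∀ {X A B} {f : X ⇒ A} {g : X ⇒ B} → ⟨ f , g ⟩ ⨾ π₁ ≈ f
    project₂ : ∀ {X A B} {f : X ⇒ A} {g : X ⇒ B} → ⟨ f , g ⟩ ⨾ π₂ ≈ g
    unique   : ∀ {X A B} {f : X ⇒ A} {g : X ⇒ B} {h : X ⇒ (A × B)} →
               h ⨾ π₁ ≈ f → h ⨾ π₂ ≈ g → h ≈ ⟨ f , g ⟩

module CartesianMonoidal {o ℓ e : Level} {C : Category o ℓ e} (K : Cartesian C) where
  open Category C
  open Cartesian K

  infixr 8 _⊗₁_
  _⊗₁_ : ∀ {A B A' B'} → A ⇒ A' → B ⇒ B' → (A × B) ⇒ (A' × B')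
  f ⊗₁ g = ⟨ π₁ ⨾ f , π₂ ⨾ g ⟩

  κ : ∀ {M Y A} → ((M × Y) × A) ⇒ ((M × A) × Y)
  κ = ⟨ ⟨ π₁ ⨾ π₁ , π₂ ⟩ , π₁ ⨾ π₂ ⟩

  assocʳ : ∀ {U B Y} → ((U × B) × Y) ⇒ (U × (B × Y))
  assocʳ = ⟨ π₁ ⨾ π₁ , ⟨ π₁ ⨾ π₂ , π₂ ⟩ ⟩

  -- The equivalence relation on  Σ W. C(P, W ⊗ Q)  whose quotient is the
  -- coend ∫^W C(P, W ⊗ Q): the equivalence relation generated by
  -- h ⨾ (r ⊗ 1_Q) ∼ h  (together with equality ≈ of morphisms in the hom-setoids).
  -- ⟨ h ⟩ = ⟨ h' ⟩  is expressed as  h ∼ h'.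
  infix 4 _∼_
  data _∼_ {P Q : Obj} : ∀ {W W' : Obj} → P ⇒ (W × Q) → P ⇒ (W' × Q) → Set (o ⊔ ℓ ⊔ e) where
    ≈⇒∼   : ∀ {W} {h h' : P ⇒ (W × Q)} → h ≈ h' → h ∼ h'
    gen   : ∀ {N W} (h : P ⇒ (N × Q)) (r : N ⇒ W) → h ⨾ (r ⊗₁ id) ∼ h
    ∼-sym : ∀ {W W'} {h : P ⇒ (W × Q)} {h' : P ⇒ (W' × Q)} → h ∼ h' → h' ∼ h
    ∼-trans : ∀ {W W' W''} {h : P ⇒ (W × Q)} {h' : P ⇒ (W' × Q)} {h'' : P ⇒ (W'' × Q)} →
              h ∼ h' → h' ∼ h'' → h ∼ h''

  -- Representatives of the class are the αᵢ : X₀ → Mᵢ ⊗ Y₀ with αᵢ ∼ α;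
  -- s assigns to each representative a morphism sᵢ : M₀ → Mᵢ (well defined on
  -- representatives, i.e. independent of the witness and of ≈).
  record Terminating {X₀ Y₀ M : Obj} (α : X₀ ⇒ (M × Y₀)) : Set (o ⊔ ℓ ⊔ e) where
    field
      M₀ : Obj
      α₀ : X₀ ⇒ (M₀ × Y₀)
      s  : ∀ {Mᵢ} (αᵢ : X₀ ⇒ (Mᵢ × Y₀)) → αᵢ ∼ α → M₀ ⇒ Mᵢ
      s-well-defined : ∀ {Mᵢ} {αᵢ αᵢ' : X₀ ⇒ (Mᵢ × Y₀)} (p : αᵢ ∼ α) (q : αᵢ' ∼ α) →
                       αᵢ ≈ αᵢ' → s αᵢ p ≈ s αᵢ' q
      factor : ∀ {Mᵢ} (αᵢ : X₀ ⇒ (Mᵢ × Y₀)) (p : αᵢ ∼ α) →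
               αᵢ ≈ α₀ ⨾ (s αᵢ p ⊗₁ id)
      cancel : ∀ {Mᵢ Mⱼ} (αᵢ : X₀ ⇒ (Mᵢ × Y₀)) (p : αᵢ ∼ α)
                 (αⱼ : X₀ ⇒ (Mⱼ × Y₀)) (q : αⱼ ∼ α)
                 {A B U V : Obj} (u : (Mᵢ × A) ⇒ (U × B)) (v : (Mⱼ × A) ⇒ (V × B)) →
               ((αᵢ ⊗₁ id {A}) ⨾ κ ⨾ (u ⊗₁ id {Y₀}) ⨾ assocʳ)
                 ∼ ((αⱼ ⊗₁ id {A}) ⨾ κ ⨾ (v ⊗₁ id {Y₀}) ⨾ assocʳ) →
               ((s αᵢ p ⊗₁ id {A}) ⨾ u) ∼ ((s αⱼ q ⊗₁ id {A}) ⨾ v)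

  -- Every class in ∫^M C(X₀, M ⊗ Y₀) has a representative α, so quantifying
  -- over all α quantifies over all classes.
  Productive : Set (o ⊔ ℓ ⊔ e)
  Productive = ∀ {X₀ Y₀ M : Obj} (α : X₀ ⇒ (M × Y₀)) → Terminating α

-- In a cartesian category the coend ∫^W C(P, W × Q) collapses to C(P, Q): the
-- Q-component h ⨾ π₂ is invariant under h ⨾ (r ⊗ 1) ∼ h, and conversely taking
-- r = ! relates every h to ⟨ ! , h ⨾ π₂ ⟩.  Hence the graph ⟨ id , α ⨾ π₂ ⟩ of the
-- Y₀-component, with memory X₀, is a terminal representative: each representative
-- αᵢ factors through it via sᵢ = αᵢ ⨾ π₁, and the cancellation condition reduces to
-- comparing B-components, where the hypothesis says exactly what is required.
module Submission where

open import Defs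
open import Level using (Level)
open import Relation.Binary using (Setoid; IsEquivalence)
import Relation.Binary.Reasoning.Setoid as SetoidReasoning

module CartesianProductive {o ℓ e : Level} {C : Category o ℓ e} (K : Cartesian C) where
  open Category C
  open Cartesian K
  open CartesianMonoidal K

  hom-setoid : Obj → Obj → Setoid ℓ e
  hom-setoid A B = record { Carrier = A ⇒ B ; _≈_ = _≈_ ; isEquivalence = ≈-equiv }

  module _ {A B : Obj} where
    open IsEquivalence (≈-equiv {A} {B}) public
      using () renaming (refl to ≈-refl; sym to ≈-sym; trans to ≈-trans)

  module HomReasoning {A B : Obj} = SetoidReasoning (hom-setoid A B)
  open HomReasoning

  ⨾-resp-≈ˡ : ∀ {A B D} {f f' : A ⇒ B} {g : B ⇒ D} → f ≈ f' → f ⨾ g ≈ f' ⨾ g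
  ⨾-resp-≈ˡ p = ⨾-resp-≈ p ≈-refl

  ⨾-resp-≈ʳ : ∀ {A B D} {f : A ⇒ B} {g g' : B ⇒ D} → g ≈ g' → f ⨾ g ≈ f ⨾ g'
  ⨾-resp-≈ʳ p = ⨾-resp-≈ ≈-refl p

  ⟨⟩-cong₂ : ∀ {X A B} {f f' : X ⇒ A} {g g' : X ⇒ B} →
             f ≈ f' → g ≈ g' → ⟨ f , g ⟩ ≈ ⟨ f' , g' ⟩
  ⟨⟩-cong₂ p q = unique (≈-trans project₁ p) (≈-trans project₂ q)

  ⨾-distrib-⟨⟩ : ∀ {Y X A B} {h : Y ⇒ X} {f : X ⇒ A} {g : X ⇒ B} →
                 h ⨾ ⟨ f , g ⟩ ≈ ⟨ h ⨾ f , h ⨾ g ⟩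
  ⨾-distrib-⟨⟩ = unique (≈-trans assoc (⨾-resp-≈ʳ project₁))
                        (≈-trans assoc (⨾-resp-≈ʳ project₂))

  ⊗₁-id-π₂ : ∀ {P N W Q} (h : P ⇒ (N × Q)) (r : N ⇒ W) → (h ⨾ (r ⊗₁ id)) ⨾ π₂ ≈ h ⨾ π₂
  ⊗₁-id-π₂ h r = ≈-trans assoc (⨾-resp-≈ʳ (≈-trans project₂ identityʳ))

  ∼⇒π₂-≈ : ∀ {P Q W W'} {h : P ⇒ (W × Q)} {h' : P ⇒ (W' × Q)} → h ∼ h' → h ⨾ π₂ ≈ h' ⨾ π₂
  ∼⇒π₂-≈ (≈⇒∼ p)       = ⨾-resp-≈ˡ p
  ∼⇒π₂-≈ (gen h r)     = ⊗₁-id-π₂ h r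
  ∼⇒π₂-≈ (∼-sym p)     = ≈-sym (∼⇒π₂-≈ p)
  ∼⇒π₂-≈ (∼-trans p q) = ≈-trans (∼⇒π₂-≈ p) (∼⇒π₂-≈ q)

  π₂-≈⇒∼ : ∀ {P Q W W'} {h : P ⇒ (W × Q)} {h' : P ⇒ (W' × Q)} → h ⨾ π₂ ≈ h' ⨾ π₂ → h ∼ h'
  π₂-≈⇒∼ {h = h} {h'} p =
    ∼-trans (∼-sym (gen h !)) (∼-trans (≈⇒∼ forget-memory) (gen h' !))
    where
      forget-memory : h ⨾ (! ⊗₁ id) ≈ h' ⨾ (! ⊗₁ id)
      forget-memory = begin
        h ⨾ (! ⊗₁ id)       ≈⟨ unique (!-unique _) (⊗₁-id-π₂ h !) ⟩
        ⟨ ! , h ⨾ π₂ ⟩      ≈⟨ ⟨⟩-cong₂ ≈-refl p ⟩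
        ⟨ ! , h' ⨾ π₂ ⟩     ≈⟨ unique (!-unique _) (⊗₁-id-π₂ h' !) ⟨
        h' ⨾ (! ⊗₁ id)      ∎

  factorise-through-graph : ∀ {P W Q} (h : P ⇒ (W × Q)) →
                            h ≈ ⟨ id , h ⨾ π₂ ⟩ ⨾ ((h ⨾ π₁) ⊗₁ id)
  factorise-through-graph h = begin
    h                                               ≈⟨ unique (≈-sym identityˡ) (≈-sym identityʳ) ⟩
    ⟨ id ⨾ (h ⨾ π₁) , (h ⨾ π₂) ⨾ id ⟩               ≈⟨ ⟨⟩-cong₂ (⨾-resp-≈ˡ project₁) (⨾-resp-≈ˡ project₂) ⟨
    ⟨ (g ⨾ π₁) ⨾ (h ⨾ π₁) , (g ⨾ π₂) ⨾ id ⟩         ≈⟨ ⟨⟩-cong₂ assoc assoc ⟩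
    ⟨ g ⨾ (π₁ ⨾ (h ⨾ π₁)) , g ⨾ (π₂ ⨾ id) ⟩         ≈⟨ ⨾-distrib-⟨⟩ ⟨
    g ⨾ ((h ⨾ π₁) ⊗₁ id)                            ∎
    where
      g = ⟨ id , h ⨾ π₂ ⟩

  ⊗₁-id-⨾-π₁π₁ : ∀ {X M Y A} (w : X ⇒ (M × Y)) →
                 (w ⊗₁ id {A}) ⨾ ⟨ π₁ ⨾ π₁ , π₂ ⟩ ≈ (w ⨾ π₁) ⊗₁ id {A}
  ⊗₁-id-⨾-π₁π₁ w = ≈-trans ⨾-distrib-⟨⟩ (⟨⟩-cong₂ first project₂)
    where
      first = begin
        (w ⊗₁ id) ⨾ (π₁ ⨾ π₁)   ≈⟨ assoc ⟨
        ((w ⊗₁ id) ⨾ π₁) ⨾ π₁   ≈⟨ ⨾-resp-≈ˡ project₁ ⟩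
        (π₁ ⨾ w) ⨾ π₁           ≈⟨ assoc ⟩
        π₁ ⨾ (w ⨾ π₁)           ∎

  assocʳ-⨾-π₂π₁ : ∀ {U B Y} → assocʳ {U} {B} {Y} ⨾ (π₂ ⨾ π₁) ≈ π₁ ⨾ π₂
  assocʳ-⨾-π₂π₁ = ≈-trans (≈-sym assoc) (≈-trans (⨾-resp-≈ˡ project₂) project₁)

  rearranged-B-component :
    ∀ {X M Y A B U} (w : X ⇒ (M × Y)) (u : (M × A) ⇒ (U × B)) →
    (((w ⊗₁ id {A}) ⨾ κ ⨾ (u ⊗₁ id {Y}) ⨾ assocʳ) ⨾ π₂) ⨾ π₁
      ≈ ((w ⨾ π₁) ⊗₁ id {A}) ⨾ (u ⨾ π₂)
  rearranged-B-component w u = begin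
    (((w ⊗₁ id) ⨾ κ ⨾ (u ⊗₁ id) ⨾ assocʳ) ⨾ π₂) ⨾ π₁   ≈⟨ assoc ⟩
    ((w ⊗₁ id) ⨾ κ ⨾ (u ⊗₁ id) ⨾ assocʳ) ⨾ (π₂ ⨾ π₁)   ≈⟨ assoc ⟩
    (w ⊗₁ id) ⨾ (κ ⨾ (u ⊗₁ id) ⨾ assocʳ) ⨾ (π₂ ⨾ π₁)   ≈⟨ ⨾-resp-≈ʳ assoc ⟩
    (w ⊗₁ id) ⨾ κ ⨾ ((u ⊗₁ id) ⨾ assocʳ) ⨾ (π₂ ⨾ π₁)   ≈⟨ ⨾-resp-≈ʳ (⨾-resp-≈ʳ assoc) ⟩
    (w ⊗₁ id) ⨾ κ ⨾ (u ⊗₁ id) ⨾ assocʳ ⨾ (π₂ ⨾ π₁)     ≈⟨ ⨾-resp-≈ʳ (⨾-resp-≈ʳ (⨾-resp-≈ʳ assocʳ-⨾-π₂π₁)) ⟩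
    (w ⊗₁ id) ⨾ κ ⨾ (u ⊗₁ id) ⨾ π₁ ⨾ π₂                ≈⟨ ⨾-resp-≈ʳ (⨾-resp-≈ʳ assoc) ⟨
    (w ⊗₁ id) ⨾ κ ⨾ ((u ⊗₁ id) ⨾ π₁) ⨾ π₂              ≈⟨ ⨾-resp-≈ʳ (⨾-resp-≈ʳ (⨾-resp-≈ˡ project₁)) ⟩
    (w ⊗₁ id) ⨾ κ ⨾ (π₁ ⨾ u) ⨾ π₂                      ≈⟨ ⨾-resp-≈ʳ (⨾-resp-≈ʳ assoc) ⟩
    (w ⊗₁ id) ⨾ κ ⨾ π₁ ⨾ (u ⨾ π₂)                      ≈⟨ ⨾-resp-≈ʳ assoc ⟨
    (w ⊗₁ id) ⨾ (κ ⨾ π₁) ⨾ (u ⨾ π₂)                    ≈⟨ ⨾-resp-≈ʳ (⨾-resp-≈ˡ project₁) ⟩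
    (w ⊗₁ id) ⨾ ⟨ π₁ ⨾ π₁ , π₂ ⟩ ⨾ (u ⨾ π₂)            ≈⟨ assoc ⟨
    ((w ⊗₁ id) ⨾ ⟨ π₁ ⨾ π₁ , π₂ ⟩) ⨾ (u ⨾ π₂)          ≈⟨ ⨾-resp-≈ˡ (⊗₁-id-⨾-π₁π₁ w) ⟩
    ((w ⨾ π₁) ⊗₁ id) ⨾ (u ⨾ π₂)                        ∎

  cancel-by-B-component :
    ∀ {X M M' Y A B U V} (w : X ⇒ (M × Y)) (w' : X ⇒ (M' × Y))
      (u : (M × A) ⇒ (U × B)) (v : (M' × A) ⇒ (V × B)) →
    ((w ⊗₁ id {A}) ⨾ κ ⨾ (u ⊗₁ id {Y}) ⨾ assocʳ) ∼ ((w' ⊗₁ id {A}) ⨾ κ ⨾ (v ⊗₁ id {Y}) ⨾ assocʳ) →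
    (((w ⨾ π₁) ⊗₁ id {A}) ⨾ u) ∼ (((w' ⨾ π₁) ⊗₁ id {A}) ⨾ v)
  cancel-by-B-component w w' u v H = π₂-≈⇒∼ (begin
    (((w ⨾ π₁) ⊗₁ id) ⨾ u) ⨾ π₂                                  ≈⟨ assoc ⟩
    ((w ⨾ π₁) ⊗₁ id) ⨾ (u ⨾ π₂)                                  ≈⟨ rearranged-B-component w u ⟨
    (((w ⊗₁ id) ⨾ κ ⨾ (u ⊗₁ id) ⨾ assocʳ) ⨾ π₂) ⨾ π₁             ≈⟨ ⨾-resp-≈ˡ (∼⇒π₂-≈ H) ⟩
    (((w' ⊗₁ id) ⨾ κ ⨾ (v ⊗₁ id) ⨾ assocʳ) ⨾ π₂) ⨾ π₁            ≈⟨ rearranged-B-component w' v ⟩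
    ((w' ⨾ π₁) ⊗₁ id) ⨾ (v ⨾ π₂)                                 ≈⟨ assoc ⟨
    (((w' ⨾ π₁) ⊗₁ id) ⨾ v) ⨾ π₂                                 ∎)

  productive : Productive
  productive {X₀} α = record
    { M₀             = X₀
    ; α₀             = ⟨ id , α ⨾ π₂ ⟩
    ; s              = λ αᵢ _ → αᵢ ⨾ π₁
    ; s-well-defined = λ _ _ → ⨾-resp-≈ˡ
    ; factor         = λ αᵢ p → ≈-trans (factorise-through-graph αᵢ)
                                        (⨾-resp-≈ˡ (⟨⟩-cong₂ ≈-refl (∼⇒π₂-≈ p)))
    ; cancel         = λ αᵢ _ αⱼ _ → cancel-by-B-component αᵢ αⱼ
    }

proposition8p7 : ∀ {o ℓ e} (C : Category o ℓ e) (K : Cartesian C) → CartesianMonoidal.Productive K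
proposition8p7 C K = CartesianProductive.productive K
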